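{- Let $(X,\sigma,\tau)$ be the solution given by a disjoint union of abelian groups $((A_i)_{i\in I},(c_{i,j})_{i,j\in I},(d_{i,j})_{i,j\in I})$. If $(X,\sigma,\tau)$ is injective, then for all $i,j\in I$ the order of $c_{i,j}+d_{i,j}$ in $A_j$ equals the order of $c_{j,i}+d_{j,i}$ in $A_i$.
   Context: A solution is a triple $(X,\sigma,\tau)$ with bijections $\sigma_x,\tau_y$ of a non-empty set $X$ such that $r(x,y)=(\sigma_x(y),\tau_y(x))$ is a bijection of $X^2$ satisfying $(\mathrm{id}\times r)(r\times\mathrm{id})(\mathrm{id}\times r)=(r\times\mathrm{id})(\mathrm{id}\times r)(r\times\mathrm{id})$. Its structure group is $G(X,r)=\langle X\mid x\circ y=\sigma_x(y)\circ\tau_y(x)\ \forall x,y\in X\rangle$, and the solution is injective if the canonical map $X\to G(X,r)$ is injective. A disjoint union of abelian groups $((A_i)_{i\in I},(c_{i,j}),(d_{i,j}))$ consists of a non-empty set $I$, abelian groups $(A_i,+)$ and constants $c_{i,j},d_{i,j}\in A_j$ with each $A_j$ generated by $\{c_{i,j},d_{i,j}: i\in I\}$; it is the solution on the disjoint union $\bigcup_i A_i$ with $\sigma_x(y)=y+c_{i,j}$ and $\tau_y(x)=x+d_{j,i}$ for $x\in A_i$, $y\in A_j$. -}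

module Defs where

open import Level using (Level; _⊔_) renaming (suc to lsuc)
open import Data.Nat using (ℕ; zero; suc; _≤_; _<_)
open import Data.Product using (Σ; _×_; _,_; ∃)
open import Data.Sum using (_⊎_; inj₁; inj₂)
open import Relation.Binary.PropositionalEquality using (_≡_)
open import Algebra.Bundles using (AbelianGroup)

-- Abelian-group notions (stdlib writes the operation of an AbelianGroup
-- as _∙_ with unit ε and inverse _⁻¹; we think of it additively).

module _ {c ℓ : Level} (G : AbelianGroup c ℓ) where
  open AbelianGroup G

  mult : ℕ → Carrier → Carrier
  mult zero    a = ε
  mult (suc n) a = a ∙ mult n a

  data Generated {k : Level} {K : Set k} (gens : K → Carrier) : Carrier → Set (c ⊔ ℓ ⊔ k) where
    gen  : ∀ x → Generated gens (gens x)
    zer  : Generated gens ε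
    neg  : ∀ {a} → Generated gens a → Generated gens (a ⁻¹)
    add  : ∀ {a b} → Generated gens a → Generated gens b → Generated gens (a ∙ b)
    resp : ∀ {a b} → a ≈ b → Generated gens a → Generated gens b

  -- "a has order n", with the convention n = 0 meaning infinite order.
  IsOrder : Carrier → ℕ → Set ℓ
  IsOrder a n =
      (n ≡ 0 × (∀ k → mult k a ≈ ε → k ≡ 0))
    ⊎ (0 < n × mult n a ≈ ε × (∀ k → 0 < k → mult k a ≈ ε → n ≤ k))

module StructureGroup {a e : Level} (X : Set a) (_≈X_ : X → X → Set e)
                      (σ τ : X → X → X) where

  data Word : Set a where
    gen  : X → Word
    one  : Word
    _·_  : Word → Word → Word
    inv  : Word → Word

  infixl 7 _·_
  infix 4 _~_

  data _~_ : Word → Word → Set (a ⊔ e) where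
    ~refl  : ∀ {u} → u ~ u
    ~sym   : ∀ {u v} → u ~ v → v ~ u
    ~trans : ∀ {u v w} → u ~ v → v ~ w → u ~ w
    ~cong· : ∀ {u u' v v'} → u ~ u' → v ~ v' → u · v ~ u' · v'
    ~cong⁻ : ∀ {u v} → u ~ v → inv u ~ inv v
    ~assoc : ∀ u v w → (u · v) · w ~ u · (v · w)
    ~idˡ   : ∀ u → one · u ~ u
    ~idʳ   : ∀ u → u · one ~ u
    ~invˡ  : ∀ u → inv u · u ~ one
    ~invʳ  : ∀ u → u · inv u ~ one
    ~gen   : ∀ {x y} → x ≈X y → gen x ~ gen y
    ~rel   : ∀ x y → gen x · gen y ~ gen (σ x y) · gen (τ y x)

  Injective : Set (a ⊔ e)
  Injective = ∀ x y → gen x ~ gen y → x ≈X y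

gensOf : ∀ {i c} {I : Set i} {C : Set c} → (I → C) → (I → C) → I ⊎ I → C
gensOf f g (inj₁ k) = f k
gensOf f g (inj₂ k) = g k

record DisjointUnion (i c ℓ : Level) : Set (lsuc (i ⊔ c ⊔ ℓ)) where
  field
    I         : Set i
    inhabited : I
    A         : I → AbelianGroup c ℓ
    cc dd     : (i j : I) → AbelianGroup.Carrier (A j)
    generated : ∀ j (x : AbelianGroup.Carrier (A j)) →
                Generated (A j) (gensOf (λ k → cc k j) (λ k → dd k j)) x

module Solution {i c ℓ : Level} (D : DisjointUnion i c ℓ) where
  open DisjointUnion D

  Carr : I → Set c
  Carr j = AbelianGroup.Carrier (A j)

  X : Set (i ⊔ c)
  X = Σ I Carr

  data _≈X_ : X → X → Set (i ⊔ c ⊔ ℓ) where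
    mk≈ : ∀ {j} {x y : Carr j} → AbelianGroup._≈_ (A j) x y → (j , x) ≈X (j , y)

  σ : X → X → X
  σ (i , x) (j , y) = j , AbelianGroup._∙_ (A j) y (cc i j)

  τ : X → X → X
  τ (j , y) (i , x) = i , AbelianGroup._∙_ (A i) x (dd j i)

  module SG = StructureGroup X _≈X_ σ τ

  IsInjective : Set (i ⊔ c ⊔ ℓ)
  IsInjective = SG.Injective

{-# OPTIONS --safe #-}
-- Applying the defining relation twice to x ∈ A_p, y ∈ A_q gives
-- x ∘ y = (x + e') ∘ (y + e) in G(X,r), where e = c_{p,q} + d_{p,q} and
-- e' = c_{q,p} + d_{q,p}; iterating, x ∘ y = (x + k e') ∘ (y + k e). If k e = 0,
-- cancelling y and using injectivity gives k e' = 0. By symmetry e and e' are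
-- annihilated by the same k, so they have the same order.
module Submission where

open import Defs
open import Level using (Level; _⊔_)
open import Data.Nat using (ℕ; zero; suc)
open import Data.Product using (_,_)
open import Data.Sum using (inj₁; inj₂)
open import Function.Bundles using (_⇔_; mk⇔; module Equivalence)
open import Function.Properties.Equivalence using () renaming (sym to ⇔-sym)
open import Relation.Binary.Bundles using (Setoid)
open import Algebra.Bundles using (AbelianGroup)
import Relation.Binary.Reasoning.Setoid as SetoidReasoning

module StructureGroupProperties {a e : Level} (X : Set a) (_≈X_ : X → X → Set e)
                                (σ τ : X → X → X) where
  open StructureGroup X _≈X_ σ τ

  ~-setoid : Setoid a (a ⊔ e)
  ~-setoid = record
    { Carrier       = Word
    ; _≈_           = _~_
    ; isEquivalence = record { refl = ~refl ; sym = ~sym ; trans = ~trans }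
    }

  ~-cancelʳ : ∀ {u v w} → u · w ~ v · w → u ~ v
  ~-cancelʳ {u} {v} {w} uw~vw = begin
    u                 ≈⟨ ~sym (~idʳ u) ⟩
    u · one           ≈⟨ ~cong· ~refl (~sym (~invʳ w)) ⟩
    u · (w · inv w)   ≈⟨ ~sym (~assoc u w (inv w)) ⟩
    (u · w) · inv w   ≈⟨ ~cong· uw~vw ~refl ⟩
    (v · w) · inv w   ≈⟨ ~assoc v w (inv w) ⟩
    v · (w · inv w)   ≈⟨ ~cong· ~refl (~invʳ w) ⟩
    v · one           ≈⟨ ~idʳ v ⟩
    v                 ∎
    where open SetoidReasoning ~-setoid

Annihilates : ∀ {c ℓ} (G : AbelianGroup c ℓ) → ℕ → AbelianGroup.Carrier G → Set ℓ
Annihilates G k a = AbelianGroup._≈_ G (mult G k a) (AbelianGroup.ε G)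

IsOrder-transfer : ∀ {c ℓ} (G H : AbelianGroup c ℓ)
  (a : AbelianGroup.Carrier G) (b : AbelianGroup.Carrier H) →
  (∀ k → Annihilates G k a ⇔ Annihilates H k b) →
  ∀ n → IsOrder G a n → IsOrder H b n
IsOrder-transfer G H a b same n (inj₁ (n≡0 , torsion-free)) =
  inj₁ (n≡0 , λ k kb≈ε → torsion-free k (Equivalence.from (same k) kb≈ε))
IsOrder-transfer G H a b same n (inj₂ (0<n , na≈ε , minimal)) =
  inj₂ (0<n , Equivalence.to (same n) na≈ε ,
        λ k 0<k kb≈ε → minimal k 0<k (Equivalence.from (same k) kb≈ε))

module DisjointUnionProperties {i c ℓ : Level} (D : DisjointUnion i c ℓ) where
  open DisjointUnion D
  open Solution D
  open SG
  open StructureGroupProperties X _≈X_ σ τ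

  gen-cong : ∀ {j} {x y : Carr j} → AbelianGroup._≈_ (A j) x y → gen (j , x) ~ gen (j , y)
  gen-cong x≈y = ~gen (mk≈ x≈y)

  gen-injective : IsInjective → ∀ {j} {x y : Carr j} →
    gen (j , x) ~ gen (j , y) → AbelianGroup._≈_ (A j) x y
  gen-injective injective {j} {x} {y} gx~gy with injective (j , x) (j , y) gx~gy
  ... | mk≈ x≈y = x≈y

  module _ (p q : I) where
    private
      module P = AbelianGroup (A p)
      module Q = AbelianGroup (A q)

    e : Q.Carrier
    e = cc p q Q.∙ dd p q

    e' : P.Carrier
    e' = cc q p P.∙ dd q p

    gen-shift : ∀ x y → gen (p , x) · gen (q , y) ~ gen (p , x P.∙ e') · gen (q , y Q.∙ e)
    gen-shift x y = begin
      gen (p , x) · gen (q , y)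
        ≈⟨ ~rel (p , x) (q , y) ⟩
      gen (q , y Q.∙ cc p q) · gen (p , x P.∙ dd q p)
        ≈⟨ ~rel (q , y Q.∙ cc p q) (p , x P.∙ dd q p) ⟩
      gen (p , (x P.∙ dd q p) P.∙ cc q p) · gen (q , (y Q.∙ cc p q) Q.∙ dd p q)
        ≈⟨ ~cong· (gen-cong x+d+c≈x+e') (gen-cong (Q.assoc y (cc p q) (dd p q))) ⟩
      gen (p , x P.∙ e') · gen (q , y Q.∙ e)
        ∎
      where
      open SetoidReasoning ~-setoid
      x+d+c≈x+e' : (x P.∙ dd q p) P.∙ cc q p P.≈ x P.∙ e'
      x+d+c≈x+e' = P.trans (P.assoc x (dd q p) (cc q p)) (P.∙-congˡ (P.comm (dd q p) (cc q p)))

    gen-shift-mult : ∀ k x y →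
      gen (p , x) · gen (q , y) ~ gen (p , x P.∙ mult (A p) k e') · gen (q , y Q.∙ mult (A q) k e)
    gen-shift-mult zero    x y =
      ~cong· (gen-cong (P.sym (P.identityʳ x))) (gen-cong (Q.sym (Q.identityʳ y)))
    gen-shift-mult (suc k) x y =
      ~trans (gen-shift x y)
        (~trans (gen-shift-mult k (x P.∙ e') (y Q.∙ e))
          (~cong· (gen-cong (P.assoc x e' _)) (gen-cong (Q.assoc y e _))))

    annihilates-swap : IsInjective → ∀ k → Annihilates (A q) k e → Annihilates (A p) k e'
    annihilates-swap injective k ke≈ε =
      P.trans (P.sym (P.identityˡ _)) (P.sym (gen-injective injective ε~ε+ke'))
      where
      ε~ε+ke' : gen (p , P.ε) ~ gen (p , P.ε P.∙ mult (A p) k e')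
      ε~ε+ke' = ~-cancelʳ (~trans (gen-shift-mult k P.ε Q.ε)
        (~cong· ~refl (gen-cong (Q.trans (Q.∙-congˡ ke≈ε) (Q.identityʳ Q.ε)))))

proposition3p16 : ∀ {i c ℓ : Level} (D : DisjointUnion i c ℓ) →
    let open DisjointUnion D in
    Solution.IsInjective D →
    ∀ (p q : I) (n : ℕ) →
      IsOrder (A q) (AbelianGroup._∙_ (A q) (cc p q) (dd p q)) n
        ⇔ IsOrder (A p) (AbelianGroup._∙_ (A p) (cc q p) (dd q p)) n
proposition3p16 D injective p q n =
  mk⇔ (IsOrder-transfer (A q) (A p) _ _ same-annihilators n)
      (IsOrder-transfer (A p) (A q) _ _ (λ k → ⇔-sym (same-annihilators k)) n)
  where
  open DisjointUnion D
  open DisjointUnionProperties D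
  same-annihilators : ∀ k → Annihilates (A q) k (e p q) ⇔ Annihilates (A p) k (e' p q)
  same-annihilators k = mk⇔ (annihilates-swap p q injective k) (annihilates-swap q p injective k)
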